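{- Let $G$ be an interval graph with interval representation $\{[\ell_v,r_v]: v\in V(G)\}$. (i) If $v_1v_2\cdots v_k$ is an induced path in $G$ and $r_{v_1}\le r_{v_k}$, then $\ell_{v_{i+1}}\le r_{v_i}<\ell_{v_{i+2}}$ for all $i\in[k-2]$. (ii) If $u$ and $v$ are distinct vertices of maximum degree $\Delta(G)$ and $w$ is a vertex of an induced $u$-$v$ path in $G$, then $[\ell_w,r_w]\subseteq[\min\{\ell_u,\ell_v\},\max\{r_u,r_v\}]$. (iii) If $G$ is connected, then there exist $x,y\in V_{\Delta}(G)$ such that $\bigcup_{v\in \operatorname{coat}_G(V_{\Delta}(G))}[\ell_v,r_v]=[\ell_x,r_y]$.
   Context: $V_{\Delta}(G)$ denotes the set of vertices of maximum degree $\Delta(G)$. For $S\subseteq V(G)$, the coating $\operatorname{coat}_G(S)$ is the set of vertices $x$ for which there exist $p_1,p_t\in S$ and an induced $p_1$-$p_t$ path $P$ in $G$ (possibly $t=1$, i.e. a single vertex) with $x\in V(P)$.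
   Formalization: The interval endpoints $\ell_v$ and $r_v$ are rational, and the union of intervals in (iii) is compared with $[\ell_x,r_y]$ pointwise over ℚ. -}

module Defs where

open import Data.Nat as ℕ using (ℕ; zero; suc)
open import Data.Fin using (Fin; _≟_)
open import Data.Rational using (ℚ; _≤_; _<_)
open import Data.Rational.Properties using (_≤?_)
open import Data.List using (List; length; filter)
open import Data.List.Base using (allFin)
open import Data.Product using (_×_; Σ; ∃; ∃-syntax; _,_)
open import Data.Sum using (_⊎_)
open import Relation.Binary.PropositionalEquality using (_≡_; _≢_)
open import Relation.Nullary using (¬_; Dec)
open import Relation.Nullary.Decidable using (_×-dec_; ¬?)
open import Function.Bundles using (_⇔_)

record IntervalRep (n : ℕ) : Set where
  field
    ℓ     : Fin n → ℚ
    r     : Fin n → ℚ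
    ℓ≤r   : ∀ v → ℓ v ≤ r v

module _ {n : ℕ} (I : IntervalRep n) where
  open IntervalRep I

  Adj : Fin n → Fin n → Set
  Adj u v = u ≢ v × (ℓ u ≤ r v × ℓ v ≤ r u)

  adj? : ∀ u v → Dec (Adj u v)
  adj? u v = ¬? (u ≟ v) ×-dec ((ℓ u ≤? r v) ×-dec (ℓ v ≤? r u))

  deg : Fin n → ℕ
  deg v = length (filter (λ u → adj? u v) (allFin n))

  MaxDeg : Fin n → Set
  MaxDeg v = ∀ u → deg u ℕ.≤ deg v

  -- p 0, p 1, …, p (k-1) is an induced path v₁v₂⋯v_k in G (k ≥ 1):
  -- distinct vertices, and two of them are adjacent iff consecutive.
  IsInducedPath : (k : ℕ) → (ℕ → Fin n) → Set
  IsInducedPath k p =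
    (1 ℕ.≤ k) ×
    ((∀ i j → i ℕ.< k → j ℕ.< k → p i ≡ p j → i ≡ j) ×
     (∀ i j → i ℕ.< k → j ℕ.< k →
        Adj (p i) (p j) ⇔ (j ≡ suc i ⊎ i ≡ suc j)))

  OnInducedPath : Fin n → Fin n → Fin n → Set
  OnInducedPath a b w =
    ∃[ k ] Σ (ℕ → Fin n) λ p →
      IsInducedPath (suc k) p × (p 0 ≡ a × (p k ≡ b ×
        (∃[ i ] (i ℕ.≤ k × p i ≡ w))))

  Coat : (Fin n → Set) → Fin n → Set
  Coat S x = ∃[ a ] ∃[ b ] (S a × (S b × OnInducedPath a b x))

  Connected : Set
  Connected =
    Fin n ×
    (∀ u v → ∃[ k ] Σ (ℕ → Fin n) λ p →
       p 0 ≡ u × (p k ≡ v × (∀ i → i ℕ.< k → Adj (p i) (p (suc i)))))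

  _∈I_ : ℚ → Fin n → Set
  q ∈I v = ℓ v ≤ q × q ≤ r v

-- Consecutive intervals of an induced path meet while intervals two apart are
-- disjoint, so the path sweeps the line in one direction; r₀ ≤ rₖ forces it to
-- sweep rightwards, which is (i).  Along a rightward path the left ends increase
-- from the second vertex on and the right ends increase up to the penultimate
-- one.  The two remaining steps follow from maximality of the degrees: if the
-- interval of an end vertex were nested in that of its neighbour, the neighbour's
-- closed neighbourhood would strictly contain the end vertex's.  This gives (ii).
-- For (iii), take x and y of maximum degree with least left end and greatest
-- right end; the coat lies in [ℓ x, r y] by (ii), and conversely the intervals
-- along an induced x–y path, obtained by shortening a walk, cover [ℓ x, r y].
{-# OPTIONS --safe #-}
module Submission where

open import Defs
open import Data.Nat as ℕ using (ℕ; suc)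
open import Data.Fin using (Fin)
open import Data.Rational using (ℚ; _≤_; _<_; _⊓_; _⊔_)
open import Data.Product using (_×_; ∃-syntax; _,_)
open import Relation.Binary.PropositionalEquality using (_≢_)
open import Function.Bundles using (_⇔_)
open IntervalRep

open import Data.Nat using (zero; z≤n; s≤s; _∸_)
import Data.Nat.Properties as ℕ
open import Data.Fin using (_≟_)
open import Data.Fin.Properties using (all?)
import Data.Rational.Properties as ℚ
open import Data.List using (List; []; _∷_; length; filter; allFin)
open import Data.List.Relation.Unary.All using (All; []; _∷_)
open import Data.List.Relation.Unary.All.Properties using (all-filter)
open import Data.List.Relation.Unary.Any using (here; there)
import Data.List.Relation.Unary.All as All
open import Data.List.Relation.Unary.AllPairs using (_∷_)
open import Data.List.Relation.Unary.Unique.Propositional using (Unique)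
open import Data.List.Relation.Unary.Unique.Propositional.Properties using (allFin⁺)
open import Data.List.Membership.Propositional using (_∈_)
open import Data.List.Membership.Propositional.Properties using (∈-allFin; ∈-filter⁺)
open import Data.Product using (∃; Σ; proj₁; proj₂)
open import Data.Sum using (_⊎_; inj₁; inj₂; [_,_]′)
open import Data.Empty using (⊥; ⊥-elim)
open import Data.Unit using (tt)
open import Function using (_∘_)
open import Level using (0ℓ)
open import Function.Bundles using (mk⇔; Equivalence)
open import Relation.Binary using (TotalOrder; DecTotalOrder; DecidableEquality; tri<; tri≈; tri>)
import Relation.Binary.Properties.TotalOrder as TotalOrderProperties
open import Relation.Binary.PropositionalEquality using (_≡_; refl; sym; trans; cong; subst; subst₂)
open import Relation.Nullary using (¬_; Dec; yes; no; contradiction)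
open import Relation.Nullary.Decidable using (_⊎-dec_)
open import Relation.Unary using (Pred; Decidable; _⊆_)

module _ {a p q} {A : Set a} {P : Pred A p} {Q : Pred A q}
         (P? : Decidable P) (Q? : Decidable Q) (P⊆Q : P ⊆ Q) where

  length-filter-mono : ∀ xs → length (filter P? xs) ℕ.≤ length (filter Q? xs)
  length-filter-mono [] = z≤n
  length-filter-mono (x ∷ xs) with P? x | Q? x
  ... | yes _  | yes _   = s≤s (length-filter-mono xs)
  ... | yes px | no ¬qx  = contradiction (P⊆Q px) ¬qx
  ... | no _   | yes _   = ℕ.m≤n⇒m≤1+n (length-filter-mono xs)
  ... | no _   | no _    = length-filter-mono xs

  length-filter-< : ∀ {x xs} → x ∈ xs → Q x → ¬ P x →
                    length (filter P? xs) ℕ.< length (filter Q? xs)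
  length-filter-< {xs = y ∷ xs} y∈ qx ¬px with P? y | Q? y | y∈
  ... | yes _  | yes _   | there x∈xs = s≤s (length-filter-< x∈xs qx ¬px)
  ... | yes py | yes _   | here refl  = contradiction py ¬px
  ... | yes py | no ¬qy  | _          = contradiction (P⊆Q py) ¬qy
  ... | no _   | yes _   | here refl  = s≤s (length-filter-mono xs)
  ... | no _   | yes _   | there x∈xs = ℕ.m≤n⇒m≤1+n (length-filter-< x∈xs qx ¬px)
  ... | no _   | no ¬qy  | here refl  = contradiction qx ¬qy
  ... | no _   | no _    | there x∈xs = length-filter-< x∈xs qx ¬px

module _ {a p} {A : Set a} (_≟_ : DecidableEquality A)
         {P : Pred A p} (P? : Decidable P) where

  private
    _≡_⊎P? : ∀ y x → Dec (y ≡ x ⊎ P y)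
    y ≡ x ⊎P? = (y ≟ x) ⊎-dec P? y

  filter-≡⊎-∉ : ∀ {x xs} → All (x ≢_) xs →
                filter (_≡ x ⊎P?) xs ≡ filter P? xs
  filter-≡⊎-∉ [] = refl
  filter-≡⊎-∉ {x} {y ∷ xs} (x≢y ∷ x∉xs) with P? y | y ≟ x
  ... | _      | yes y≡x = contradiction (sym y≡x) x≢y
  ... | yes _  | no _    = cong (y ∷_) (filter-≡⊎-∉ x∉xs)
  ... | no _   | no _    = filter-≡⊎-∉ x∉xs

  length-filter-≡⊎ : ∀ {x xs} → Unique xs → x ∈ xs → ¬ P x →
                     length (filter (_≡ x ⊎P?) xs) ≡ suc (length (filter P? xs))
  length-filter-≡⊎ {x} {y ∷ xs} (y∉xs ∷ unique) x∈ ¬px with P? y | y ≟ x | x∈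
  ... | yes py | _        | here refl  = contradiction py ¬px
  ... | no _   | no y≢x   | here refl  = contradiction refl y≢x
  ... | no _   | yes _    | here refl  = cong (suc ∘ length) (filter-≡⊎-∉ y∉xs)
  ... | _      | yes refl | there x∈xs = contradiction refl (All.lookup y∉xs x∈xs)
  ... | yes _  | no _     | there x∈xs = cong suc (length-filter-≡⊎ unique x∈xs ¬px)
  ... | no _   | no _     | there x∈xs = length-filter-≡⊎ unique x∈xs ¬px

module _ {c ℓ₁ ℓ₂} (O : TotalOrder c ℓ₁ ℓ₂) where
  private module O = TotalOrder O
  open import Data.List.Extrema O using (argmin; argmin-all; f[argmin]≤f[xs])

  ∃-argmin : ∀ {n p} {P : Pred (Fin n) p} → Decidable P → ∃ P → (f : Fin n → O.Carrier) →
             ∃[ x ] (P x × (∀ y → P y → f x O.≤ f y))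
  ∃-argmin {n} P? (v , pv) f =
    x , argmin-all f pv (all-filter P? (allFin n)) ,
    λ y py → All.lookup (f[argmin]≤f[xs] v xs) (∈-filter⁺ P? (∈-allFin y) py)
    where
    xs : List (Fin n)
    xs = filter P? (allFin n)
    x : Fin n
    x = argmin f v xs

∃-least : ∀ {p} {P : Pred ℕ p} → Decidable P → ∀ {k} → P k →
          ∃[ m ] (m ℕ.≤ k × P m × (∀ {i} → i ℕ.< m → ¬ P i))
∃-least P? {zero} p0 = 0 , z≤n , p0 , λ ()
∃-least {P = P} P? {suc k} pk with P? 0
... | yes p0 = 0 , z≤n , p0 , λ ()
... | no ¬p0 with ∃-least (P? ∘ suc) pk
...   | m , m≤k , pm , ¬p<m = suc m , s≤s m≤k , pm , ¬p<1+m
  where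
  ¬p<1+m : ∀ {i} → i ℕ.< suc m → ¬ P i
  ¬p<1+m {zero}  _         = ¬p0
  ¬p<1+m {suc i} (s≤s i<m) = ¬p<m i<m

≤-from-steps : ∀ {k} (f : ℕ → ℚ) → (∀ {j} → j ℕ.< k → f j ≤ f (suc j)) →
               ∀ {i j} → i ℕ.≤ j → j ℕ.≤ k → f i ≤ f j
≤-from-steps f step i≤j j≤k = go (ℕ.≤⇒≤′ i≤j) j≤k
  where
  go : ∀ {i j} → i ℕ.≤′ j → j ℕ.≤ _ → f i ≤ f j
  go ℕ.≤′-refl         _   = ℚ.≤-refl
  go (ℕ.≤′-step i≤′j) j<k = ℚ.≤-trans (go i≤′j (ℕ.<⇒≤ j<k)) (step j<k)

snoc : ∀ {a} {A : Set a} → ℕ → (ℕ → A) → A → ℕ → A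
snoc zero    p z zero    = p zero
snoc zero    p z (suc j) = z
snoc (suc m) p z zero    = p zero
snoc (suc m) p z (suc j) = snoc m (p ∘ suc) z j

snoc-≤ : ∀ {a} {A : Set a} m (p : ℕ → A) z {j} → j ℕ.≤ m → snoc m p z j ≡ p j
snoc-≤ zero    p z z≤n       = refl
snoc-≤ (suc m) p z z≤n       = refl
snoc-≤ (suc m) p z (s≤s j≤m) = snoc-≤ m (p ∘ suc) z j≤m

snoc-last : ∀ {a} {A : Set a} m (p : ℕ → A) z → snoc m p z (suc m) ≡ z
snoc-last zero    p z = refl
snoc-last (suc m) p z = snoc-last m (p ∘ suc) z

ℚ-≤ ℚ-≥ : TotalOrder 0ℓ 0ℓ 0ℓ
ℚ-≤ = DecTotalOrder.totalOrder ℚ.≤-decTotalOrder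
ℚ-≥ = TotalOrderProperties.≥-totalOrder ℚ-≤

ℕ-≥ : TotalOrder 0ℓ 0ℓ 0ℓ
ℕ-≥ = TotalOrderProperties.≥-totalOrder ℕ.≤-totalOrder

module _ {n : ℕ} (I : IntervalRep n) where

  Adj-sym : ∀ {u v} → Adj I u v → Adj I v u
  Adj-sym (u≢v , ℓu≤rv , ℓv≤ru) = u≢v ∘ sym , ℓv≤ru , ℓu≤rv

  Adj-irrefl : ∀ {v} → ¬ Adj I v v
  Adj-irrefl (v≢v , _) = v≢v refl

  ¬Adj⇒disjoint : ∀ {u v} → u ≢ v → ¬ Adj I u v → r I u < ℓ I v ⊎ r I v < ℓ I u
  ¬Adj⇒disjoint {u} {v} u≢v ¬u~v with ℓ I u ℚ.≤? r I v | ℓ I v ℚ.≤? r I u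
  ... | yes ℓu≤rv | yes ℓv≤ru = contradiction (u≢v , ℓu≤rv , ℓv≤ru) ¬u~v
  ... | _         | no ℓv≰ru  = inj₁ (ℚ.≰⇒> ℓv≰ru)
  ... | no ℓu≰rv  | _         = inj₂ (ℚ.≰⇒> ℓu≰rv)

  _∈N[_] : Fin n → Fin n → Set
  u ∈N[ v ] = u ≡ v ⊎ Adj I u v

  _∈N?[_] : ∀ u v → Dec (u ∈N[ v ])
  u ∈N?[ v ] = (u ≟ v) ⊎-dec adj? I u v

  ∈N[]-sym : ∀ {u v} → u ∈N[ v ] → v ∈N[ u ]
  ∈N[]-sym (inj₁ u≡v) = inj₁ (sym u≡v)
  ∈N[]-sym (inj₂ u~v) = inj₂ (Adj-sym u~v)

  N[_] : Fin n → List (Fin n)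
  N[ v ] = filter (_∈N?[ v ]) (allFin n)

  length-N[] : ∀ v → length N[ v ] ≡ suc (deg I v)
  length-N[] v = length-filter-≡⊎ _≟_ (λ u → adj? I u v) (allFin⁺ n) (∈-allFin v) (Adj-irrefl)

  nested⇒N[]⊆ : ∀ {a b} → a ≢ b → ℓ I b ≤ ℓ I a → r I a ≤ r I b → ∀ {u} → u ∈N[ a ] → u ∈N[ b ]
  nested⇒N[]⊆ {a} {b} a≢b ℓb≤ℓa ra≤rb {u} u∈N[a] with u ≟ b
  ... | yes u≡b = inj₁ u≡b
  ... | no u≢b with u∈N[a]
  ...   | inj₁ refl = inj₂ (a≢b , ℚ.≤-trans (ℓ≤r I a) ra≤rb , ℚ.≤-trans ℓb≤ℓa (ℓ≤r I a))
  ...   | inj₂ (_ , ℓu≤ra , ℓa≤ru) = inj₂ (u≢b , ℚ.≤-trans ℓu≤ra ra≤rb , ℚ.≤-trans ℓb≤ℓa ℓa≤ru)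

  nested⇒deg< : ∀ {a b c} → a ≢ b → ℓ I b ≤ ℓ I a → r I a ≤ r I b →
                c ∈N[ b ] → ¬ c ∈N[ a ] → deg I a ℕ.< deg I b
  nested⇒deg< {a} {b} {c} a≢b ℓb≤ℓa ra≤rb c∈N[b] c∉N[a] = ℕ.s≤s⁻¹ (begin-strict
    suc (deg I a)   ≡⟨ sym (length-N[] a) ⟩
    length N[ a ]   <⟨ length-filter-< (_∈N?[ a ]) (_∈N?[ b ]) (nested⇒N[]⊆ a≢b ℓb≤ℓa ra≤rb)
                                       (∈-allFin c) c∈N[b] c∉N[a] ⟩
    length N[ b ]   ≡⟨ length-N[] b ⟩
    suc (deg I b)   ∎)
    where open ℕ.≤-Reasoning

  maxDeg-not-nested : ∀ {a b c} → MaxDeg I a → a ≢ b → ℓ I b ≤ ℓ I a → r I a ≤ r I b →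
                      c ∈N[ b ] → ¬ c ∈N[ a ] → ⊥
  maxDeg-not-nested Δa a≢b ℓb≤ℓa ra≤rb c∈N[b] c∉N[a] =
    ℕ.<⇒≱ (nested⇒deg< a≢b ℓb≤ℓa ra≤rb c∈N[b] c∉N[a]) (Δa _)

  Walk : ℕ → (ℕ → Fin n) → Set
  Walk k p = ∀ i → i ℕ.< k → Adj I (p i) (p (suc i))

  Chordless : ℕ → (ℕ → Fin n) → Set
  Chordless k p = ∀ {i j} → 2 ℕ.+ i ℕ.≤ j → j ℕ.≤ k → ¬ p j ∈N[ p i ]

  induced⇒walk : ∀ {k p} → IsInducedPath I (suc k) p → Walk k p
  induced⇒walk (_ , _ , adjacent) i i<k =
    Equivalence.from (adjacent i (suc i) (ℕ.m≤n⇒m≤1+n i<k) (s≤s i<k)) (inj₁ refl)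

  induced⇒chordless : ∀ {k p} → IsInducedPath I (suc k) p → Chordless k p
  induced⇒chordless (_ , injective , adjacent) {i} {j} 2+i≤j j≤k = λ where
      (inj₁ pj≡pi) → ℕ.<⇒≢ i<j (sym (injective j i (s≤s j≤k) (s≤s i≤k) pj≡pi))
      (inj₂ pj~pi) → [ (λ i≡1+j → ℕ.<-asym i<j (subst (j ℕ.<_) (sym i≡1+j) ℕ.≤-refl))
                     , (λ j≡1+i → ℕ.<-irrefl (sym j≡1+i) 2+i≤j)
                     ]′ (Equivalence.to (adjacent j i (s≤s j≤k) (s≤s i≤k)) pj~pi)
    where
    i<j : i ℕ.< j
    i<j = ℕ.<⇒≤ 2+i≤j
    i≤k : i ℕ.≤ _
    i≤k = ℕ.<⇒≤ (ℕ.<-≤-trans i<j j≤k)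

  walk+chordless⇒induced : ∀ {k p} → Walk k p → Chordless k p → IsInducedPath I (suc k) p
  walk+chordless⇒induced {k} {p} walk chordless = s≤s z≤n , injective , adjacent
    where
    later : ∀ {i j} → i ℕ.< j → j ℕ.≤ k → p j ≢ p i × (Adj I (p j) (p i) → j ≡ suc i)
    later {i} {j} i<j j≤k with ℕ.m≤n⇒m<n∨m≡n i<j
    ... | inj₂ refl  = (λ pj≡pi → Adj-irrefl (subst (Adj I (p i)) pj≡pi (walk i j≤k))) , λ _ → refl
    ... | inj₁ 2+i≤j = (λ pj≡pi → chordless 2+i≤j j≤k (inj₁ pj≡pi))
                     , (λ pj~pi → contradiction (inj₂ pj~pi) (chordless 2+i≤j j≤k))

    injective : ∀ i j → i ℕ.< suc k → j ℕ.< suc k → p i ≡ p j → i ≡ j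
    injective i j i≤k j≤k pi≡pj with ℕ.<-cmp i j
    ... | tri< i<j _ _ = contradiction (sym pi≡pj) (proj₁ (later i<j (ℕ.s≤s⁻¹ j≤k)))
    ... | tri≈ _ i≡j _ = i≡j
    ... | tri> _ _ j<i = contradiction pi≡pj (proj₁ (later j<i (ℕ.s≤s⁻¹ i≤k)))

    adjacent : ∀ i j → i ℕ.< suc k → j ℕ.< suc k →
               Adj I (p i) (p j) ⇔ (j ≡ suc i ⊎ i ≡ suc j)
    adjacent i j i≤k j≤k = mk⇔ to from
      where
      to : Adj I (p i) (p j) → j ≡ suc i ⊎ i ≡ suc j
      to pi~pj with ℕ.<-cmp i j
      ... | tri< i<j _ _    = inj₁ (proj₂ (later i<j (ℕ.s≤s⁻¹ j≤k)) (Adj-sym pi~pj))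
      ... | tri≈ _ refl _   = contradiction pi~pj Adj-irrefl
      ... | tri> _ _ j<i    = inj₂ (proj₂ (later j<i (ℕ.s≤s⁻¹ i≤k)) pi~pj)
      from : j ≡ suc i ⊎ i ≡ suc j → Adj I (p i) (p j)
      from (inj₁ refl) = walk i (ℕ.s≤s⁻¹ j≤k)
      from (inj₂ refl) = Adj-sym (walk j (ℕ.s≤s⁻¹ i≤k))

  reverse-walk : ∀ {k p} → Walk k p → Walk k (λ j → p (k ∸ j))
  reverse-walk {k} {p} walk i i<k =
    subst (λ m → Adj I (p m) (p (k ∸ suc i))) (sym (ℕ.+-∸-assoc 1 i<k))
          (Adj-sym (walk (k ∸ suc i) (ℕ.∸-monoʳ-< (s≤s z≤n) i<k)))

  reverse-chordless : ∀ {k p} → Chordless k p → Chordless k (λ j → p (k ∸ j))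
  reverse-chordless {k} chordless {i} {j} 2+i≤j j≤k =
    chordless 2+[k∸j]≤k∸i (ℕ.m∸n≤m k i) ∘ ∈N[]-sym
    where
    2+[k∸j]≤k∸i : 2 ℕ.+ (k ∸ j) ℕ.≤ k ∸ i
    2+[k∸j]≤k∸i = subst (ℕ._≤ k ∸ i) (ℕ.+-∸-assoc 2 j≤k) (ℕ.∸-monoʳ-≤ (2 ℕ.+ k) 2+i≤j)

  onInducedPath-sym : ∀ {a b w} → OnInducedPath I a b w → OnInducedPath I b a w
  onInducedPath-sym (k , p , induced , p0≡a , pk≡b , i , i≤k , pi≡w) =
    k , (λ j → p (k ∸ j)) ,
    walk+chordless⇒induced (reverse-walk (induced⇒walk induced))
                           (reverse-chordless (induced⇒chordless induced)) ,
    pk≡b , trans (cong p (ℕ.n∸n≡0 k)) p0≡a ,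
    k ∸ i , ℕ.m∸n≤m k i , trans (cong p (ℕ.m∸[m∸n]≡n i≤k)) pi≡w

  module Sweep {k p} (walk : Walk k p) (chordless : Chordless k p) where
    open ℚ.≤-Reasoning

    ℓ[1+j]≤r[j] : ∀ {j} → j ℕ.< k → ℓ I (p (suc j)) ≤ r I (p j)
    ℓ[1+j]≤r[j] j<k = proj₂ (proj₂ (walk _ j<k))

    ℓ[j]≤r[1+j] : ∀ {j} → j ℕ.< k → ℓ I (p j) ≤ r I (p (suc j))
    ℓ[j]≤r[1+j] j<k = proj₁ (proj₂ (walk _ j<k))

    Rightward Leftward : ℕ → Set
    Rightward i = r I (p i) < ℓ I (p (2 ℕ.+ i))
    Leftward  i = r I (p (2 ℕ.+ i)) < ℓ I (p i)

    rightward⊎leftward : ∀ {i} → 2 ℕ.+ i ℕ.≤ k → Rightward i ⊎ Leftward i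
    rightward⊎leftward {i} 2+i≤k =
      ¬Adj⇒disjoint (p[2+i]∉N[p[i]] ∘ inj₁ ∘ sym) (p[2+i]∉N[p[i]] ∘ inj₂ ∘ Adj-sym)
      where
      p[2+i]∉N[p[i]] : ¬ p (2 ℕ.+ i) ∈N[ p i ]
      p[2+i]∉N[p[i]] = chordless ℕ.≤-refl 2+i≤k

    rightward-step : ∀ {i} → 3 ℕ.+ i ℕ.≤ k → Rightward i → Rightward (suc i)
    rightward-step {i} 3+i≤k right with rightward⊎leftward 3+i≤k
    ... | inj₁ right′ = right′
    ... | inj₂ left′  = begin-contradiction
      ℓ I (p (2 ℕ.+ i))  ≤⟨ ℓ[j]≤r[1+j] 3+i≤k ⟩
      r I (p (3 ℕ.+ i))  <⟨ left′ ⟩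
      ℓ I (p (1 ℕ.+ i))  ≤⟨ ℓ[1+j]≤r[j] (ℕ.m+n≤o⇒n≤o 2 3+i≤k) ⟩
      r I (p i)          <⟨ right ⟩
      ℓ I (p (2 ℕ.+ i))  ∎

    leftward-step : ∀ {i} → 3 ℕ.+ i ℕ.≤ k → Leftward i → Leftward (suc i)
    leftward-step {i} 3+i≤k left with rightward⊎leftward 3+i≤k
    ... | inj₂ left′  = left′
    ... | inj₁ right′ = begin-contradiction
      r I (p (1 ℕ.+ i))  <⟨ right′ ⟩
      ℓ I (p (3 ℕ.+ i))  ≤⟨ ℓ[1+j]≤r[j] 3+i≤k ⟩
      r I (p (2 ℕ.+ i))  <⟨ left ⟩
      ℓ I (p i)          ≤⟨ ℓ[j]≤r[1+j] (ℕ.m+n≤o⇒n≤o 2 3+i≤k) ⟩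
      r I (p (1 ℕ.+ i))  ∎

    propagate : ∀ {P : ℕ → Set} → P 0 → (∀ {i} → 3 ℕ.+ i ℕ.≤ k → P i → P (suc i)) →
                ∀ {i} → 2 ℕ.+ i ℕ.≤ k → P i
    propagate p0 step {zero}  _     = p0
    propagate p0 step {suc i} 3+i≤k = step 3+i≤k (propagate p0 step (ℕ.<⇒≤ 3+i≤k))

    leftward⇒r<r[0] : (∀ {i} → 2 ℕ.+ i ℕ.≤ k → Leftward i) →
                      ∀ {j} → 2 ℕ.≤ j → j ℕ.≤ k → r I (p j) < r I (p 0)
    leftward⇒r<r[0] left {0} () _
    leftward⇒r<r[0] left {1} (s≤s ()) _
    leftward⇒r<r[0] left {2} _ 2≤k = begin-strict
      r I (p 2)  <⟨ left 2≤k ⟩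
      ℓ I (p 0)  ≤⟨ ℓ≤r I (p 0) ⟩
      r I (p 0)  ∎
    leftward⇒r<r[0] left {suc (suc (suc j))} _ 3+j≤k = begin-strict
      r I (p (3 ℕ.+ j))  <⟨ left 3+j≤k ⟩
      ℓ I (p (1 ℕ.+ j))  ≤⟨ ℓ[j]≤r[1+j] (ℕ.<⇒≤ 3+j≤k) ⟩
      r I (p (2 ℕ.+ j))  <⟨ leftward⇒r<r[0] left {suc (suc j)} (s≤s (s≤s z≤n)) (ℕ.<⇒≤ 3+j≤k) ⟩
      r I (p 0)          ∎

    rightward : r I (p 0) ≤ r I (p k) → ∀ {i} → 2 ℕ.+ i ℕ.≤ k → Rightward i
    rightward r₀≤rₖ {i} 2+i≤k with rightward⊎leftward {0} (ℕ.m+n≤o⇒m≤o 2 2+i≤k)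
    ... | inj₁ right = propagate right rightward-step 2+i≤k
    ... | inj₂ left  = begin-contradiction
      r I (p 0)  ≤⟨ r₀≤rₖ ⟩
      r I (p k)  <⟨ leftward⇒r<r[0] (propagate left leftward-step) (ℕ.m+n≤o⇒m≤o 2 2+i≤k) ℕ.≤-refl ⟩
      r I (p 0)  ∎

  induced-path-rightward : ∀ {k p} → IsInducedPath I (suc k) p → r I (p 0) ≤ r I (p k) →
                           ∀ {i} → 2 ℕ.+ i ℕ.≤ k →
                           ℓ I (p (suc i)) ≤ r I (p i) × r I (p i) < ℓ I (p (2 ℕ.+ i))
  induced-path-rightward induced r₀≤rₖ 2+i≤k =
    ℓ[1+j]≤r[j] (ℕ.<⇒≤ 2+i≤k) , rightward r₀≤rₖ 2+i≤k
    where open Sweep (induced⇒walk induced) (induced⇒chordless induced)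

  module MaxDegPath {k p} (walk : Walk k p) (chordless : Chordless k p)
                    (Δ₀ : MaxDeg I (p 0)) (Δₖ : MaxDeg I (p k))
                    (r₀≤rₖ : r I (p 0) ≤ r I (p k)) (2≤k : 2 ℕ.≤ k) where
    open Sweep walk chordless

    ℓ-step : ∀ {j} → j ℕ.< k → ℓ I (p j) ≤ ℓ I (p (suc j))
    ℓ-step {zero} _ with ℓ I (p 0) ℚ.≤? ℓ I (p 1)
    ... | yes ℓ₀≤ℓ₁ = ℓ₀≤ℓ₁
    ... | no ℓ₀≰ℓ₁ = ⊥-elim (maxDeg-not-nested Δ₀ (proj₁ (walk 0 (ℕ.<⇒≤ 2≤k)))
                               (ℚ.<⇒≤ (ℚ.≰⇒> ℓ₀≰ℓ₁)) r₀≤r₁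
                               (inj₂ (Adj-sym (walk 1 2≤k))) (chordless ℕ.≤-refl 2≤k))
      where
      r₀≤r₁ : r I (p 0) ≤ r I (p 1)
      r₀≤r₁ = ℚ.<⇒≤ (ℚ.<-≤-trans (rightward r₀≤rₖ 2≤k) (ℓ[1+j]≤r[j] 2≤k))
    ℓ-step {suc j} 2+j≤k = ℚ.<⇒≤ (ℚ.≤-<-trans (ℓ[1+j]≤r[j] (ℕ.<⇒≤ 2+j≤k)) (rightward r₀≤rₖ 2+j≤k))

    r-step : ∀ {j} → j ℕ.< k → r I (p j) ≤ r I (p (suc j))
    r-step {j} j<k with ℕ.m≤n⇒m<n∨m≡n j<k
    ... | inj₁ 2+j≤k = ℚ.<⇒≤ (ℚ.<-≤-trans (rightward r₀≤rₖ 2+j≤k) (ℓ[1+j]≤r[j] 2+j≤k))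
    ... | inj₂ 1+j≡k = last-step 1+j≡k
      where
      last-step : ∀ {j} → suc j ≡ k → r I (p j) ≤ r I (p (suc j))
      last-step {zero} refl = contradiction 2≤k (ℕ.<-irrefl refl)
      last-step {suc j} refl with r I (p (1 ℕ.+ j)) ℚ.≤? r I (p (2 ℕ.+ j))
      ... | yes r≤r = r≤r
      ... | no r≰r = ⊥-elim (maxDeg-not-nested Δₖ (proj₁ (Adj-sym (walk (suc j) ℕ.≤-refl)))
                               ℓ≤ℓ (ℚ.<⇒≤ (ℚ.≰⇒> r≰r))
                               (inj₂ (walk j (ℕ.m≤n⇒m≤1+n ℕ.≤-refl)))
                               (chordless ℕ.≤-refl ℕ.≤-refl ∘ ∈N[]-sym))
        where
        ℓ≤ℓ : ℓ I (p (1 ℕ.+ j)) ≤ ℓ I (p (2 ℕ.+ j))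
        ℓ≤ℓ = ℚ.<⇒≤ (ℚ.≤-<-trans (ℓ[1+j]≤r[j] (ℕ.m≤n⇒m≤1+n ℕ.≤-refl)) (rightward r₀≤rₖ ℕ.≤-refl))

    bounds : ∀ {i} → i ℕ.≤ k → ℓ I (p 0) ≤ ℓ I (p i) × r I (p i) ≤ r I (p k)
    bounds i≤k = ≤-from-steps (ℓ I ∘ p) ℓ-step z≤n i≤k , ≤-from-steps (r I ∘ p) r-step i≤k ℕ.≤-refl

  interior-hull : ∀ {a b w} → MaxDeg I a → MaxDeg I b → r I a ≤ r I b →
                  OnInducedPath I a b w → w ≢ a → w ≢ b → ℓ I a ≤ ℓ I w × r I w ≤ r I b
  interior-hull Δa Δb ra≤rb (k , p , induced , refl , refl , zero , _ , refl) w≢a _ =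
    contradiction refl w≢a
  interior-hull Δa Δb ra≤rb (k , p , induced , refl , refl , suc i , 1+i≤k , refl) _ w≢b =
    MaxDegPath.bounds (induced⇒walk induced) (induced⇒chordless induced) Δa Δb ra≤rb 2≤k 1+i≤k
    where
    2≤k : 2 ℕ.≤ k
    2≤k = ℕ.m+n≤o⇒m≤o 2 (ℕ.≤∧≢⇒< 1+i≤k (w≢b ∘ cong p))

  onInducedPath-hull : ∀ {a b w} → MaxDeg I a → MaxDeg I b → OnInducedPath I a b w →
                       ℓ I a ⊓ ℓ I b ≤ ℓ I w × r I w ≤ r I a ⊔ r I b
  onInducedPath-hull {a} {b} {w} Δa Δb on
    with w ≟ a | w ≟ b | ℚ.≤-total (r I a) (r I b)
  ... | yes refl | _        | _ = ℚ.p⊓q≤p (ℓ I a) _ , ℚ.p≤p⊔q (r I a) _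
  ... | no _     | yes refl | _ = ℚ.p⊓q≤q (ℓ I a) _ , ℚ.p≤q⊔p (r I a) _
  ... | no w≢a   | no w≢b   | inj₁ ra≤rb =
    let ℓa≤ℓw , rw≤rb = interior-hull Δa Δb ra≤rb on w≢a w≢b
    in  ℚ.≤-trans (ℚ.p⊓q≤p _ (ℓ I b)) ℓa≤ℓw , ℚ.≤-trans rw≤rb (ℚ.p≤q⊔p (r I a) _)
  ... | no w≢a   | no w≢b   | inj₂ rb≤ra =
    let ℓb≤ℓw , rw≤ra = interior-hull Δb Δa rb≤ra (onInducedPath-sym on) w≢b w≢a
    in  ℚ.≤-trans (ℚ.p⊓q≤q (ℓ I a) _) ℓb≤ℓw , ℚ.≤-trans rw≤ra (ℚ.p≤p⊔q _ (r I b))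

  InducedPathBetween : Fin n → Fin n → Set
  InducedPathBetween u v =
    ∃[ k ] Σ (ℕ → Fin n) λ p → Walk k p × Chordless k p × p 0 ≡ u × p k ≡ v

  -- Cut the path at the first vertex that z equals or is adjacent to.
  extend : ∀ {k p z} → Walk k p → Chordless k p → Adj I (p k) z → InducedPathBetween (p 0) z
  extend {k} {p} {z} walk chordless pk~z
    with ∃-least (λ i → z ∈N?[ p i ]) {k} (inj₂ (Adj-sym pk~z))
  ... | m , m≤k , inj₁ z≡pm , _ =
    m , p , (λ i i<m → walk i (ℕ.<-≤-trans i<m m≤k)) ,
    (λ 2+i≤j j≤m → chordless 2+i≤j (ℕ.≤-trans j≤m m≤k)) , refl , sym z≡pm
  ... | m , m≤k , inj₂ z~pm , z∉N[p<m] =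
    suc m , q , walk′ , chordless′ , q≡p z≤n , q[1+m]≡z
    where
    q : ℕ → Fin n
    q = snoc m p z

    q≡p : ∀ {j} → j ℕ.≤ m → q j ≡ p j
    q≡p = snoc-≤ m p z

    q[1+m]≡z : q (suc m) ≡ z
    q[1+m]≡z = snoc-last m p z

    walk′ : Walk (suc m) q
    walk′ i i≤m with ℕ.m≤n⇒m<n∨m≡n (ℕ.s≤s⁻¹ i≤m)
    ... | inj₁ i<m = subst₂ (Adj I) (sym (q≡p (ℕ.<⇒≤ i<m))) (sym (q≡p i<m))
                            (walk i (ℕ.<-≤-trans i<m m≤k))
    ... | inj₂ refl = subst₂ (Adj I) (sym (q≡p ℕ.≤-refl)) (sym q[1+m]≡z) (Adj-sym z~pm)

    chordless′ : Chordless (suc m) q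
    chordless′ {i} {j} 2+i≤j j≤1+m with ℕ.m≤n⇒m<n∨m≡n j≤1+m
    ... | inj₁ j≤m = subst₂ (λ u v → ¬ u ∈N[ v ]) (sym (q≡p (ℕ.s≤s⁻¹ j≤m)))
                            (sym (q≡p (ℕ.≤-trans (ℕ.m+n≤o⇒n≤o 2 2+i≤j) (ℕ.s≤s⁻¹ j≤m))))
                            (chordless 2+i≤j (ℕ.≤-trans (ℕ.s≤s⁻¹ j≤m) m≤k))
    ... | inj₂ refl = subst₂ (λ u v → ¬ u ∈N[ v ]) (sym q[1+m]≡z) (sym (q≡p (ℕ.<⇒≤ i<m)))
                             (z∉N[p<m] i<m)
      where
      i<m : i ℕ.< m
      i<m = ℕ.s≤s⁻¹ 2+i≤j

  walk⇒inducedPath : ∀ k {p} → Walk k p → InducedPathBetween (p 0) (p k)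
  walk⇒inducedPath zero {p} _ = 0 , p , (λ _ ()) , no-chord , refl , refl
    where
    no-chord : Chordless 0 p
    no-chord (s≤s _) ()
  walk⇒inducedPath (suc k) {p} walk
    with walk⇒inducedPath k (λ i i<k → walk i (ℕ.m≤n⇒m≤1+n i<k))
  ... | k′ , q , walk′ , chordless′ , q0≡p0 , qk′≡pk =
    subst (λ u → InducedPathBetween u (p (suc k))) q0≡p0
          (extend walk′ chordless′ (subst (λ v → Adj I v (p (suc k))) (sym qk′≡pk) (walk k ℕ.≤-refl)))

  walk-covers : ∀ k {p q} → Walk k p → ℓ I (p 0) ≤ q → q ≤ r I (p k) →
                ∃[ i ] (i ℕ.≤ k × _∈I_ I q (p i))
  walk-covers zero _ ℓ₀≤q q≤r₀ = 0 , z≤n , ℓ₀≤q , q≤r₀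
  walk-covers (suc k) {p} {q} walk ℓ₀≤q q≤rₖ with q ℚ.≤? r I (p 0)
  ... | yes q≤r₀ = 0 , z≤n , ℓ₀≤q , q≤r₀
  ... | no q≰r₀ =
    let i , i≤k , q∈p[1+i] = walk-covers k (λ i i<k → walk (suc i) (s≤s i<k)) ℓ₁≤q q≤rₖ
    in  suc i , s≤s i≤k , q∈p[1+i]
    where
    ℓ₁≤q : ℓ I (p 1) ≤ q
    ℓ₁≤q = ℚ.≤-trans (proj₂ (proj₂ (walk 0 (s≤s z≤n)))) (ℚ.<⇒≤ (ℚ.≰⇒> q≰r₀))

  maxDeg? : ∀ v → Dec (MaxDeg I v)
  maxDeg? v = all? (λ u → deg I u ℕ.≤? deg I v)

  maxDeg-exists : Fin n → ∃ (MaxDeg I)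
  maxDeg-exists v₀ =
    let d , _ , d-max = ∃-argmin ℕ-≥ (λ _ → yes tt) (v₀ , tt) (deg I)
    in  d , λ u → d-max u tt

  coat⊆hull : ∀ {x y v q} →
              (∀ a → MaxDeg I a → ℓ I x ≤ ℓ I a) → (∀ b → MaxDeg I b → r I b ≤ r I y) →
              Coat I (MaxDeg I) v → _∈I_ I q v → ℓ I x ≤ q × q ≤ r I y
  coat⊆hull x-least y-greatest (a , b , Δa , Δb , on) (ℓv≤q , q≤rv) =
    let ℓa⊓ℓb≤ℓv , rv≤ra⊔rb = onInducedPath-hull Δa Δb on
    in  ℚ.≤-trans (ℚ.⊓-glb (x-least a Δa) (x-least b Δb)) (ℚ.≤-trans ℓa⊓ℓb≤ℓv ℓv≤q) ,
        ℚ.≤-trans q≤rv (ℚ.≤-trans rv≤ra⊔rb (ℚ.⊔-lub (y-greatest a Δa) (y-greatest b Δb)))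

  hull⊆coat : ∀ {x y q} → Connected I → MaxDeg I x → MaxDeg I y → ℓ I x ≤ q → q ≤ r I y →
              ∃[ v ] (Coat I (MaxDeg I) v × _∈I_ I q v)
  hull⊆coat {x} {y} {q} (_ , connected) Δx Δy ℓx≤q q≤ry
    with k , p , p0≡x , pk≡y , walk ← connected x y
    with k′ , p′ , walk′ , chordless′ , p′0≡x , p′k′≡y ←
         subst₂ InducedPathBetween p0≡x pk≡y (walk⇒inducedPath k walk)
    with i , i≤k′ , q∈p′i ← walk-covers k′ walk′ (subst (λ u → ℓ I u ≤ q) (sym p′0≡x) ℓx≤q)
                                                 (subst (λ u → q ≤ r I u) (sym p′k′≡y) q≤ry)
    = p′ i , (x , y , Δx , Δy , k′ , p′ , walk+chordless⇒induced walk′ chordless′ ,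
              p′0≡x , p′k′≡y , i , i≤k′ , refl) , q∈p′i

  coat-hull : Connected I →
    ∃[ x ] ∃[ y ] (MaxDeg I x × (MaxDeg I y ×
      (∀ (q : ℚ) → (∃[ v ] (Coat I (MaxDeg I) v × _∈I_ I q v)) ⇔ (ℓ I x ≤ q × q ≤ r I y))))
  coat-hull connected@(v₀ , _) =
    let x , Δx , x-least    = ∃-argmin ℚ-≤ maxDeg? (maxDeg-exists v₀) (ℓ I)
        y , Δy , y-greatest = ∃-argmin ℚ-≥ maxDeg? (maxDeg-exists v₀) (r I)
    in  x , y , Δx , Δy , λ q → mk⇔ (λ (_ , coat , q∈v) → coat⊆hull x-least y-greatest coat q∈v)
                                    (λ (ℓx≤q , q≤ry) → hull⊆coat connected Δx Δy ℓx≤q q≤ry)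

lemma17 :
    -- (i)
    (∀ (n : ℕ) (I : IntervalRep n) (k : ℕ) (p : ℕ → Fin n) →
       IsInducedPath I (suc k) p → r I (p 0) ≤ r I (p k) →
       ∀ i → suc (suc i) ℕ.≤ k →
         ℓ I (p (suc i)) ≤ r I (p i) × r I (p i) < ℓ I (p (suc (suc i))))
    ×
    -- (ii)
    ((∀ (n : ℕ) (I : IntervalRep n) (u v w : Fin n) →
       u ≢ v → MaxDeg I u → MaxDeg I v → OnInducedPath I u v w →
         (ℓ I u ⊓ ℓ I v) ≤ ℓ I w × r I w ≤ (r I u ⊔ r I v))
    ×
    -- (iii)
     (∀ (n : ℕ) (I : IntervalRep n) → Connected I →
       ∃[ x ] ∃[ y ] (MaxDeg I x × (MaxDeg I y ×
         (∀ (q : ℚ) →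
            (∃[ v ] (Coat I (MaxDeg I) v × _∈I_ I q v))
              ⇔ (ℓ I x ≤ q × q ≤ r I y))))))
lemma17 =
  (λ n I k p induced r₀≤rₖ i → induced-path-rightward I induced r₀≤rₖ) ,
  -- (ii) holds without the hypothesis u ≢ v
  (λ n I u v w _ → onInducedPath-hull I) ,
  (λ n I → coat-hull I)
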